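{- Let $n\ge 1$ and let $G$ be a self-complementary graph on $4n$ vertices, and suppose there is an isomorphism $\rho: G\to cG$ which, viewed as a permutation of $V(G)$, is a single cycle of length $4n$. Let $L$ be the set of edges of $G$ joining a vertex of degree at least $2n$ to a vertex of degree at most $2n-1$. Then $G$ contains a $K_{2n}$ minor obtained by contracting $2n$ pairwise nonadjacent edges belonging to $L$.
   Context: Graphs are finite, simple and undirected. $cG$ denotes the complement of $G$ (same vertex set, two distinct vertices adjacent in $cG$ iff not adjacent in $G$); $G$ is self-complementary if $G\cong cG$. A minor is obtained by edge deletions, vertex deletions and edge contractions. (In a self-complementary graph on $4n$ vertices exactly $2n$ vertices have degree at least $2n$ and the other $2n$ have degree at most $2n-1$.) -}

module Defs where

open import Data.Nat using (ℕ; zero; suc; _+_; _*_; _∸_; _≤_; _≥_)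
open import Data.Bool using (Bool; true; false; not; _∧_; if_then_else_)
open import Data.Fin using (Fin; _≟_)
open import Data.List using (map; allFin)
open import Data.Nat.ListAction using (sum)
open import Data.Product using (Σ; _×_; ∃-syntax)
open import Data.Sum using (_⊎_)
open import Relation.Nullary using (¬_; yes; no)
open import Relation.Nullary.Decidable using (⌊_⌋)
open import Relation.Binary.PropositionalEquality as P using (_≡_; _≢_; refl)
open import Data.Empty using (⊥-elim)
open import Data.Bool.Properties using (∧-zeroʳ)
open import Data.Fin.Permutation using (Permutation′; _⟨$⟩ʳ_)

record Graph (m : ℕ) : Set where
  field
    adj   : Fin m → Fin m → Bool
    sym   : ∀ u v → adj u v ≡ adj v u
    irref : ∀ v → adj v v ≡ false
open Graph public

Adj : ∀ {m} → Graph m → Fin m → Fin m → Set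
Adj G u v = adj G u v ≡ true

deg : ∀ {m} → Graph m → Fin m → ℕ
deg {m} G v = sum (map (λ u → if adj G v u then 1 else 0) (allFin m))

cadj : ∀ {m} → Graph m → Fin m → Fin m → Bool
cadj G u v = not (adj G u v) ∧ not ⌊ u ≟ v ⌋

private
  ≟-sym : ∀ {m} (u v : Fin m) → ⌊ u ≟ v ⌋ ≡ ⌊ v ≟ u ⌋
  ≟-sym u v with u ≟ v | v ≟ u
  ... | yes _ | yes _ = refl
  ... | no _  | no _  = refl
  ... | yes p | no q  = ⊥-elim (q (P.sym p))
  ... | no p  | yes q = ⊥-elim (p (P.sym q))

  ≟-refl : ∀ {m} (v : Fin m) → ⌊ v ≟ v ⌋ ≡ true
  ≟-refl v with v ≟ v
  ... | yes _ = refl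
  ... | no q  = ⊥-elim (q refl)

c : ∀ {m} → Graph m → Graph m
c G = record
  { adj   = cadj G
  ; sym   = λ u v → P.cong₂ (λ x y → not x ∧ not y) (sym G u v) (≟-sym u v)
  ; irref = λ v → P.trans (P.cong (λ y → not (adj G v v) ∧ not y) (≟-refl v))
                          (∧-zeroʳ (not (adj G v v)))
  }

IsIso : ∀ {m} → Graph m → Graph m → Permutation′ m → Set
IsIso G H ρ = ∀ u v → adj G u v ≡ adj H (ρ ⟨$⟩ʳ u) (ρ ⟨$⟩ʳ v)

iter : ∀ {m} → Permutation′ m → ℕ → Fin m → Fin m
iter ρ zero    v = v
iter ρ (suc k) v = ρ ⟨$⟩ʳ (iter ρ k v)

-- ρ, as a permutation of Fin m, is a single cycle of length m:
-- it has exactly one orbit, i.e. every vertex is reached from every other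
IsSingleCycle : ∀ {m} → Permutation′ m → Set
IsSingleCycle {m} ρ = ∀ u v → ∃[ k ] iter ρ k u ≡ v

InL : ∀ {n} → Graph (4 * n) → Fin (4 * n) → Fin (4 * n) → Set
InL {n} G u v =
  Adj G u v ×
  ((deg G u ≥ 2 * n × deg G v ≤ 2 * n ∸ 1) ⊎ (deg G v ≥ 2 * n × deg G u ≤ 2 * n ∸ 1))

-- G has a K_{2n} minor obtained by contracting 2n pairwise nonadjacent
-- (i.e. vertex-disjoint) edges a i — b i (i : Fin (2n)) belonging to L:
-- the contracted vertices {a i, b i} are pairwise adjacent in the contraction.
HasLMatchingK2nMinor : ∀ n → Graph (4 * n) → Set
HasLMatchingK2nMinor n G =
  Σ (Fin (2 * n) → Fin (4 * n)) λ a →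
  Σ (Fin (2 * n) → Fin (4 * n)) λ b →
    (∀ i → InL {n} G (a i) (b i)) ×
    (∀ i j → i ≢ j → a i ≢ a j × a i ≢ b j × b i ≢ a j × b i ≢ b j) ×
    (∀ i j → i ≢ j →
       Adj G (a i) (a j) ⊎ Adj G (a i) (b j) ⊎ Adj G (b i) (a j) ⊎ Adj G (b i) (b j))

-- ρ maps G onto its complement, so ρ² is an automorphism of G, and deg v + deg (ρ v) = 4n - 1
-- for every v; hence every edge v ρ(v) lies in L. Walking along the single 4n-cycle of ρ,
-- one of the pairs u₀ ρ(u₀), ρ(u₀) ρ²(u₀) is an edge, and its images under the powers of ρ²
-- are 2n vertex-disjoint edges ρ^{2t}(u₀) ρ^{2t+1}(u₀). For t ≠ t' the pair ρ^{2t}(u₀), ρ^{2t'}(u₀)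
-- is mapped by ρ to the pair ρ^{2t+1}(u₀), ρ^{2t'+1}(u₀), so exactly one of the two pairs is an
-- edge of G: the contracted edges are pairwise joined.
module Submission where

open import Defs hiding (sym)
open import Data.Bool using (Bool; true; false; not; if_then_else_)
open import Data.Bool.Properties using (∧-identityʳ; not-involutive)
open import Data.Empty using (⊥-elim)
open import Data.Fin using (Fin; zero; suc; toℕ; fromℕ<; combine; remQuot; _≟_)
open import Data.Fin.Patterns using (0F; 1F)
open import Data.Fin.Permutation using (Permutation′; _⟨$⟩ʳ_)
open import Data.Fin.Properties
  using (toℕ<n; toℕ-fromℕ<; toℕ-injective; injective⇒≤; toℕ-combine; remQuot-combine)
open import Data.List using (map; allFin; tabulate)
open import Data.List.Properties using (map-tabulate)
open import Data.Nat using (ℕ; zero; suc; _+_; _*_; _∸_; _≤_; _<_; NonZero; z≤n; s≤s)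
open import Data.Nat.DivMod using (_%_; _/_; m%n<n; m≡m%n+[m/n]*n)
open import Data.Nat.ListAction using (sum)
open import Data.Nat.Properties hiding (_≟_)
open import Data.Product using (_×_; _,_; proj₁; proj₂; ∃-syntax)
open import Data.Sum using (_⊎_; inj₁; inj₂)
open import Function using (_∘_; id)
open import Function.Bundles using (Injection)
open import Function.Properties.Inverse using (↔⇒↣)
open import Relation.Binary.PropositionalEquality
open import Relation.Nullary using (yes; no)
open import Relation.Nullary.Decidable using (⌊_⌋)
open import Algebra.Properties.CommutativeMonoid.Sum +-0-commutativeMonoid
  using (sum-syntax; sum-cong-≗; ∑-distrib-+; sum-permute; sum-replicate-zero)

χ : Bool → ℕ
χ b = if b then 1 else 0

sum-map-allFin : ∀ {k} (f : Fin k → ℕ) → sum (map f (allFin k)) ≡ ∑[ i < k ] f i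
sum-map-allFin f = trans (cong sum (map-tabulate id f)) (sum-tabulate f)
  where
  sum-tabulate : ∀ {k} (f : Fin k → ℕ) → sum (tabulate f) ≡ ∑[ i < k ] f i
  sum-tabulate {zero}  f = refl
  sum-tabulate {suc k} f = cong (f zero +_) (sum-tabulate (f ∘ suc))

∑-const-1 : ∀ k → ∑[ i < k ] 1 ≡ k
∑-const-1 zero    = refl
∑-const-1 (suc k) = cong suc (∑-const-1 k)

∑-δ : ∀ {k} (v : Fin k) → ∑[ u < k ] χ ⌊ v ≟ u ⌋ ≡ 1
∑-δ {suc k} zero    = cong suc (sum-replicate-zero k)
∑-δ {suc k} (suc v) = trans (sum-cong-≗ (cong χ ∘ ⌊suc≟suc⌋ v)) (∑-δ v)
  where
  ⌊suc≟suc⌋ : ∀ {k} (v u : Fin k) → ⌊ suc v ≟ suc u ⌋ ≡ ⌊ v ≟ u ⌋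
  ⌊suc≟suc⌋ v u with v ≟ u
  ... | yes _ = refl
  ... | no _  = refl

permute-injective : ∀ {m} (ρ : Permutation′ m) {u v} → ρ ⟨$⟩ʳ u ≡ ρ ⟨$⟩ʳ v → u ≡ v
permute-injective ρ = Injection.injective (↔⇒↣ ρ)

module _ {m : ℕ} where

  deg-∑ : (G : Graph m) (v : Fin m) → deg G v ≡ ∑[ u < m ] χ (adj G v u)
  deg-∑ G v = sum-map-allFin (χ ∘ adj G v)

  adj-complement : (G : Graph m) {u v : Fin m} → u ≢ v → adj (c G) u v ≡ not (adj G u v)
  adj-complement G {u} {v} u≢v with u ≟ v
  ... | yes u≡v = ⊥-elim (u≢v u≡v)
  ... | no _    = ∧-identityʳ (not (adj G u v))

  deg-+-deg-complement : (G : Graph m) (v : Fin m) → deg G v + deg (c G) v + 1 ≡ m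
  deg-+-deg-complement G v = begin
    deg G v + deg (c G) v + 1
      ≡⟨ cong₂ (λ x y → x + y + 1) (deg-∑ G v) (deg-∑ (c G) v) ⟩
    ∑[ u < m ] χ (adj G v u) + ∑[ u < m ] χ (cadj G v u) + 1
      ≡⟨ cong₂ _+_ (∑-distrib-+ (χ ∘ adj G v) (χ ∘ cadj G v)) (∑-δ v) ⟨
    ∑[ u < m ] (χ (adj G v u) + χ (cadj G v u)) + ∑[ u < m ] χ ⌊ v ≟ u ⌋
      ≡⟨ ∑-distrib-+ (λ u → χ (adj G v u) + χ (cadj G v u)) (λ u → χ ⌊ v ≟ u ⌋) ⟨
    ∑[ u < m ] (χ (adj G v u) + χ (cadj G v u) + χ ⌊ v ≟ u ⌋)
      ≡⟨ sum-cong-≗ one-of-three ⟩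
    ∑[ u < m ] 1
      ≡⟨ ∑-const-1 m ⟩
    m ∎
    where
    open ≡-Reasoning
    one-of-three : ∀ u → χ (adj G v u) + χ (cadj G v u) + χ ⌊ v ≟ u ⌋ ≡ 1
    one-of-three u with v ≟ u
    ... | yes refl rewrite irref G v = refl
    ... | no _ with adj G v u
    ...   | true  = refl
    ...   | false = refl

  deg-iso : ∀ {G H : Graph m} {ρ} → IsIso G H ρ → ∀ v → deg G v ≡ deg H (ρ ⟨$⟩ʳ v)
  deg-iso {G} {H} {ρ} iso v = begin
    deg G v                                ≡⟨ deg-∑ G v ⟩
    ∑[ u < m ] χ (adj G v u)               ≡⟨ sum-cong-≗ (cong χ ∘ iso v) ⟩
    ∑[ u < m ] χ (adj H (ρ′ v) (ρ′ u))     ≡⟨ sum-permute (χ ∘ adj H (ρ′ v)) ρ ⟨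
    ∑[ u < m ] χ (adj H (ρ′ v) u)          ≡⟨ deg-∑ H (ρ′ v) ⟨
    deg H (ρ′ v)                           ∎
    where
    open ≡-Reasoning
    ρ′ : Fin m → Fin m
    ρ′ = ρ ⟨$⟩ʳ_

module _ {m : ℕ} (ρ : Permutation′ m) where

  iter-+ : ∀ j k u → iter ρ (j + k) u ≡ iter ρ j (iter ρ k u)
  iter-+ zero    k u = refl
  iter-+ (suc j) k u = cong (ρ ⟨$⟩ʳ_) (iter-+ j k u)

  iter-comm : ∀ k u → iter ρ k (ρ ⟨$⟩ʳ u) ≡ ρ ⟨$⟩ʳ iter ρ k u
  iter-comm zero    u = refl
  iter-comm (suc k) u = cong (ρ ⟨$⟩ʳ_) (iter-comm k u)

  iter-*-fixed : ∀ {p u} → iter ρ p u ≡ u → ∀ q → iter ρ (q * p) u ≡ u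
  iter-*-fixed         fixed zero    = refl
  iter-*-fixed {p} {u} fixed (suc q) =
    trans (iter-+ p (q * p) u) (trans (cong (iter ρ p) (iter-*-fixed fixed q)) fixed)

  iter-% : ∀ {p u} .{{_ : NonZero p}} → iter ρ p u ≡ u → ∀ k → iter ρ (k % p) u ≡ iter ρ k u
  iter-% {p} {u} fixed k = begin
    iter ρ (k % p) u                        ≡⟨ cong (iter ρ (k % p)) (iter-*-fixed fixed (k / p)) ⟨
    iter ρ (k % p) (iter ρ (k / p * p) u)   ≡⟨ iter-+ (k % p) (k / p * p) u ⟨
    iter ρ (k % p + k / p * p) u            ≡⟨ cong (λ j → iter ρ j u) (m≡m%n+[m/n]*n k p) ⟨
    iter ρ k u                              ∎
    where open ≡-Reasoning

  module _ (G : Graph m) {p : ℕ}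
           (invariant : ∀ u v → adj G (iter ρ p u) (iter ρ p v) ≡ adj G u v) where

    adj-iter-* : ∀ t u v → adj G (iter ρ (t * p) u) (iter ρ (t * p) v) ≡ adj G u v
    adj-iter-* zero    u v = refl
    adj-iter-* (suc t) u v = begin
      adj G (iter ρ (p + t * p) u) (iter ρ (p + t * p) v)
        ≡⟨ cong₂ (adj G) (iter-+ p (t * p) u) (iter-+ p (t * p) v) ⟩
      adj G (iter ρ p (iter ρ (t * p) u)) (iter ρ p (iter ρ (t * p) v))
        ≡⟨ invariant _ _ ⟩
      adj G (iter ρ (t * p) u) (iter ρ (t * p) v)
        ≡⟨ adj-iter-* t u v ⟩
      adj G u v ∎
      where open ≡-Reasoning

module _ {m : ℕ} {ρ : Permutation′ m} (cycle : IsSingleCycle ρ) where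

  -- u reaches every vertex, and already within p steps, so there are at most p vertices.
  period-≥ : ∀ {p u} .{{_ : NonZero p}} → iter ρ p u ≡ u → m ≤ p
  period-≥ {p} {u} fixed = injective⇒≤ {f = steps} steps-injective
    where
    steps : Fin m → Fin p
    steps v = fromℕ< (m%n<n (proj₁ (cycle u v)) p)
    iter-steps : ∀ v → iter ρ (toℕ (steps v)) u ≡ v
    iter-steps v = begin
      iter ρ (toℕ (steps v)) u
        ≡⟨ cong (λ k → iter ρ k u) (toℕ-fromℕ< (m%n<n (proj₁ (cycle u v)) p)) ⟩
      iter ρ (proj₁ (cycle u v) % p) u
        ≡⟨ iter-% ρ fixed _ ⟩
      iter ρ (proj₁ (cycle u v)) u
        ≡⟨ proj₂ (cycle u v) ⟩
      v ∎
      where open ≡-Reasoning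
    steps-injective : ∀ {v w} → steps v ≡ steps w → v ≡ w
    steps-injective {v} {w} eq =
      trans (sym (iter-steps v)) (trans (cong (λ r → iter ρ (toℕ r) u) eq) (iter-steps w))

  iter-injective : ∀ {i j u} → i < m → j < m → iter ρ i u ≡ iter ρ j u → i ≡ j
  iter-injective {zero}  {zero}  _   _   _  = refl
  iter-injective {zero}  {suc j} _   j<m eq = ⊥-elim (<⇒≱ j<m (period-≥ (sym eq)))
  iter-injective {suc i} {zero}  i<m _   eq = ⊥-elim (<⇒≱ i<m (period-≥ eq))
  iter-injective {suc i} {suc j} i<m j<m eq =
    cong suc (iter-injective (m+1<n⇒m<n i<m) (m+1<n⇒m<n j<m) (permute-injective ρ eq))
    where
    m+1<n⇒m<n : ∀ {k} → suc k < m → k < m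
    m+1<n⇒m<n = ≤-trans (n≤1+n _)

  no-fixed-point : 2 ≤ m → ∀ u → u ≢ ρ ⟨$⟩ʳ u
  no-fixed-point 2≤m u eq with iter-injective {0} {1} (≤-trans (s≤s z≤n) 2≤m) 2≤m eq
  ... | ()

module SelfComplementary {m : ℕ} (G : Graph m) (ρ : Permutation′ m) (iso : IsIso G (c G) ρ) where

  adj-ρ : ∀ {u v} → u ≢ v → adj G (ρ ⟨$⟩ʳ u) (ρ ⟨$⟩ʳ v) ≡ not (adj G u v)
  adj-ρ {u} {v} u≢v = begin
    adj G (ρ ⟨$⟩ʳ u) (ρ ⟨$⟩ʳ v)              ≡⟨ not-involutive _ ⟨
    not (not (adj G (ρ ⟨$⟩ʳ u) (ρ ⟨$⟩ʳ v)))  ≡⟨ cong not (adj-complement G (u≢v ∘ permute-injective ρ)) ⟨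
    not (adj (c G) (ρ ⟨$⟩ʳ u) (ρ ⟨$⟩ʳ v))    ≡⟨ cong not (iso u v) ⟨
    not (adj G u v)                          ∎
    where open ≡-Reasoning

  adj-ρ² : ∀ u v → adj G (iter ρ 2 u) (iter ρ 2 v) ≡ adj G u v
  adj-ρ² u v with u ≟ v
  ... | yes refl = trans (irref G _) (sym (irref G u))
  ... | no u≢v   = begin
    adj G (iter ρ 2 u) (iter ρ 2 v)  ≡⟨ adj-ρ (u≢v ∘ permute-injective ρ) ⟩
    not (adj G (ρ ⟨$⟩ʳ u) (ρ ⟨$⟩ʳ v)) ≡⟨ cong not (adj-ρ u≢v) ⟩
    not (not (adj G u v))            ≡⟨ not-involutive _ ⟩
    adj G u v                        ∎
    where open ≡-Reasoning

  deg-+-deg-ρ : ∀ v → deg G v + deg G (ρ ⟨$⟩ʳ v) + 1 ≡ m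
  deg-+-deg-ρ v = begin
    deg G v + deg G (ρ ⟨$⟩ʳ v) + 1
      ≡⟨ cong (λ d → d + deg G (ρ ⟨$⟩ʳ v) + 1) (deg-iso {G = G} {c G} {ρ} iso v) ⟩
    deg (c G) (ρ ⟨$⟩ʳ v) + deg G (ρ ⟨$⟩ʳ v) + 1
      ≡⟨ cong (_+ 1) (+-comm (deg (c G) (ρ ⟨$⟩ʳ v)) _) ⟩
    deg G (ρ ⟨$⟩ʳ v) + deg (c G) (ρ ⟨$⟩ʳ v) + 1
      ≡⟨ deg-+-deg-complement G (ρ ⟨$⟩ʳ v) ⟩
    m ∎
    where open ≡-Reasoning

  edge-along-ρ : ∀ {u} → u ≢ ρ ⟨$⟩ʳ u → ∃[ v ] Adj G v (ρ ⟨$⟩ʳ v)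
  edge-along-ρ {u} u≢ρu with adj G u (ρ ⟨$⟩ʳ u) in eq
  ... | true  = u , eq
  ... | false = ρ ⟨$⟩ʳ u , trans (adj-ρ u≢ρu) (cong not eq)

split-at-half : ∀ {x y} K → x + y + 1 ≡ K + K → (K ≤ x × y ≤ K ∸ 1) ⊎ (K ≤ y × x ≤ K ∸ 1)
split-at-half {x} {y} K sum≡ with K ≤? x
... | yes K≤x = inj₁ (K≤x , ∸-monoˡ-≤ 1 (+-cancelˡ-≤ K (suc y) K (begin
  K + suc y    ≤⟨ +-monoˡ-≤ (suc y) K≤x ⟩
  x + suc y    ≡⟨ +-suc x y ⟩
  suc (x + y)  ≡⟨ +-comm 1 (x + y) ⟩
  x + y + 1    ≡⟨ sum≡ ⟩
  K + K        ∎)))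
  where open ≤-Reasoning
... | no K≰x = inj₂ (+-cancelˡ-≤ K K y (begin
  K + K        ≡⟨ sum≡ ⟨
  x + y + 1    ≡⟨ +-comm (x + y) 1 ⟩
  suc x + y    ≤⟨ +-monoˡ-≤ y (≰⇒> K≰x) ⟩
  K + y        ∎) , ∸-monoˡ-≤ 1 (≰⇒> K≰x))
  where open ≤-Reasoning

module Matching (n : ℕ) (G : Graph (4 * n)) (ρ : Permutation′ (4 * n))
                (iso : IsIso G (c G) ρ) (cycle : IsSingleCycle ρ)
                (u₀ : Fin (4 * n)) (edge : Adj G u₀ (ρ ⟨$⟩ʳ u₀)) where

  open SelfComplementary G ρ iso

  position : Fin (2 * n) → Fin 2 → ℕ
  position i e = toℕ e + toℕ i * 2

  position≡toℕ-combine : ∀ i e → position i e ≡ toℕ (combine i e)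
  position≡toℕ-combine i e = begin
    toℕ e + toℕ i * 2   ≡⟨ +-comm (toℕ e) _ ⟩
    toℕ i * 2 + toℕ e   ≡⟨ cong (_+ toℕ e) (*-comm (toℕ i) 2) ⟩
    2 * toℕ i + toℕ e   ≡⟨ toℕ-combine i e ⟨
    toℕ (combine i e)   ∎
    where open ≡-Reasoning

  position-< : ∀ i e → position i e < 4 * n
  position-< i e = begin-strict
    position i e        ≡⟨ position≡toℕ-combine i e ⟩
    toℕ (combine i e)   <⟨ toℕ<n (combine i e) ⟩
    2 * n * 2           ≡⟨ *-comm (2 * n) 2 ⟩
    2 * (2 * n)         ≡⟨ *-assoc 2 2 n ⟨
    4 * n               ∎
    where open ≤-Reasoning

  position-injective : ∀ {i j e e′} → position i e ≡ position j e′ → i ≡ j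
  position-injective {i} {j} {e} {e′} eq = cong proj₁ (begin
    (i , e)                   ≡⟨ remQuot-combine i e ⟨
    remQuot 2 (combine i e)   ≡⟨ cong (remQuot 2) (toℕ-injective combine≡) ⟩
    remQuot 2 (combine j e′)  ≡⟨ remQuot-combine j e′ ⟩
    (j , e′)                  ∎)
    where
    open ≡-Reasoning
    combine≡ : toℕ (combine i e) ≡ toℕ (combine j e′)
    combine≡ = trans (sym (position≡toℕ-combine i e)) (trans eq (position≡toℕ-combine j e′))

  vertex : Fin (2 * n) → Fin 2 → Fin (4 * n)
  vertex i e = iter ρ (position i e) u₀

  vertex-disjoint : ∀ {i j} → i ≢ j → ∀ e e′ → vertex i e ≢ vertex j e′
  vertex-disjoint {i} {j} i≢j e e′ =
    i≢j ∘ position-injective ∘ iter-injective cycle (position-< i e) (position-< j e′)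

  -- b i reduces to ρ ⟨$⟩ʳ a i, so ρ carries a i, a j onto b i, b j.
  a b : Fin (2 * n) → Fin (4 * n)
  a i = vertex i 0F
  b i = vertex i 1F

  edge-a-b : ∀ i → Adj G (a i) (b i)
  edge-a-b i = begin
    adj G (a i) (b i)                           ≡⟨ cong (adj G (a i)) (iter-comm ρ t u₀) ⟨
    adj G (iter ρ t u₀) (iter ρ t (ρ ⟨$⟩ʳ u₀))  ≡⟨ adj-iter-* ρ G adj-ρ² (toℕ i) u₀ (ρ ⟨$⟩ʳ u₀) ⟩
    adj G u₀ (ρ ⟨$⟩ʳ u₀)                        ≡⟨ edge ⟩
    true                                        ∎
    where
    open ≡-Reasoning
    t : ℕ
    t = toℕ i * 2

  edge-∈L : ∀ i → InL {n} G (a i) (b i)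
  edge-∈L i = edge-a-b i , split-at-half (2 * n) (trans (deg-+-deg-ρ (a i)) (*-distribʳ-+ n 2 2))

  disjoint : ∀ i j → i ≢ j → a i ≢ a j × a i ≢ b j × b i ≢ a j × b i ≢ b j
  disjoint i j i≢j =
    vertex-disjoint i≢j 0F 0F , vertex-disjoint i≢j 0F 1F ,
    vertex-disjoint i≢j 1F 0F , vertex-disjoint i≢j 1F 1F

  joined : ∀ i j → i ≢ j →
    Adj G (a i) (a j) ⊎ Adj G (a i) (b j) ⊎ Adj G (b i) (a j) ⊎ Adj G (b i) (b j)
  joined i j i≢j with adj G (a i) (a j) in eq
  ... | true  = inj₁ refl
  ... | false = inj₂ (inj₂ (inj₂ (trans (adj-ρ (vertex-disjoint i≢j 0F 0F)) (cong not eq))))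

  minor : HasLMatchingK2nMinor n G
  minor = a , b , edge-∈L , disjoint , joined

lemma4 : (n : ℕ) → 1 ≤ n → (G : Graph (4 * n)) → (ρ : Permutation′ (4 * n)) →
    IsIso G (c G) ρ → IsSingleCycle ρ → HasLMatchingK2nMinor n G
lemma4 n 1≤n G ρ iso cycle = Matching.minor n G ρ iso cycle (proj₁ edge) (proj₂ edge)
  where
  2≤4n : 2 ≤ 4 * n
  2≤4n = ≤-trans (s≤s (s≤s z≤n)) (*-monoʳ-≤ 4 1≤n)
  v₀ : Fin (4 * n)
  v₀ = fromℕ< (≤-trans (s≤s z≤n) 2≤4n)
  edge : ∃[ u ] Adj G u (ρ ⟨$⟩ʳ u)
  edge = SelfComplementary.edge-along-ρ G ρ iso (no-fixed-point cycle 2≤4n v₀)
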